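{- Let $p$ be a prime with $p \equiv 1 \pmod 4$. Suppose there exist positive integers $x \le y \le z$ with $$\frac{4}{p} = \frac{1}{x} + \frac{1}{y} + \frac{1}{z}$$ and $p \nmid y$. Then there exists a nonnegative integer $k$ such that $$z = \frac{(4k+3)p^{2} + p}{4}.$$
   Context: A solution for a prime $p$ is a triple of positive integers $x \le y \le z$ with $\frac{4}{p} = \frac{1}{x} + \frac{1}{y} + \frac{1}{z}$. It is called a Type I solution when $p \nmid y$ and a Type II solution when $p \mid y$. -}

module Defs where

module Submission where

open import Defs
open import Data.Nat using (ℕ; _≤_; _*_; _+_; _^_; NonZero)
open import Data.Nat.Divisibility using (_∣_)
open import Data.Nat.Primality using (Prime)
open import Data.Nat.DivMod using (_%_)
open import Data.Integer using (+_)
open import Data.Rational using (ℚ; _/_) renaming (_+_ to _+ℚ_)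
open import Data.Product using (∃)
open import Relation.Binary.PropositionalEquality using (_≡_)
open import Relation.Nullary using (¬_)

open import Data.Nat using (suc; _<_; s≤s; ≢-nonZero⁻¹)
open import Data.Nat.Properties
open import Data.Nat.Divisibility using (_∤_; divides; ∣⇒≤; n∣m⇒m%n≡0)
open import Data.Nat.Primality using (euclidsLemma; prime⇒nonZero; ¬prime[1])
open import Data.Nat.DivMod using (m≡m%n+[m/n]*n; %-distribˡ-*; m%n%n≡m%n; %-pred-≡0)
  renaming (_/_ to _div_)
open import Data.Nat.Tactic.RingSolver using (solve-∀)
import Data.Integer.Properties as ℤ
open import Data.Integer using (∣_∣)
open import Data.Rational using (toℚᵘ)
open import Data.Rational.Properties using (toℚᵘ-cong; toℚᵘ-homo-+; toℚᵘ-fromℚᵘ)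
import Data.Rational.Unnormalised as ℚᵘ
open import Data.Rational.Unnormalised.Properties using (+-cong; ≃-refl; module ≃-Reasoning)
open import Data.Product using (_,_)
open import Data.Sum using (inj₁; inj₂)
open import Data.Empty using (⊥; ⊥-elim)
open import Relation.Binary.PropositionalEquality using (refl; sym; trans; cong; module ≡-Reasoning)

-- Clearing denominators gives 4xyz = p(xy + xz + yz). As 1/x is the largest of the collect
-- terms, 4/p ≤ 3/x, so x < p; with p ∤ y and p ∤ 4 this forces p ∣ z. Writing z = wp and
-- cancelling p leaves xy(4w − 1) = (x + y)wp, hence p ∣ 4w − 1 because p ∤ xy; say
-- 4w − 1 = mp. Reducing mod 4 with p ≡ 1 gives m ≡ 3, and 4z = (mp + 1)p.

n/p≡1/x+1/y+1/z⇒ : ∀ n p x y z .{{_ : NonZero p}} .{{_ : NonZero x}} .{{_ : NonZero y}}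
  .{{_ : NonZero z}} →
  + n / p ≡ (+ 1 / x +ℚ + 1 / y) +ℚ + 1 / z →
  n * (x * y * z) ≡ (x * y + (x + y) * z) * p
n/p≡1/x+1/y+1/z⇒ n (suc p) (suc x) (suc y) (suc z) eq with ≃ᵘ
  where
  open ≃-Reasoning
  ≃ᵘ : + n ℚᵘ./ suc p ℚᵘ.≃ (+ 1 ℚᵘ./ suc x ℚᵘ.+ + 1 ℚᵘ./ suc y) ℚᵘ.+ + 1 ℚᵘ./ suc z
  ≃ᵘ = begin
    + n ℚᵘ./ suc p
      ≈⟨ toℚᵘ-fromℚᵘ (+ n ℚᵘ./ suc p) ⟨
    toℚᵘ (+ n / suc p)
      ≈⟨ toℚᵘ-cong eq ⟩
    toℚᵘ ((+ 1 / suc x +ℚ + 1 / suc y) +ℚ + 1 / suc z)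
      ≈⟨ toℚᵘ-homo-+ (+ 1 / suc x +ℚ + 1 / suc y) (+ 1 / suc z) ⟩
    toℚᵘ (+ 1 / suc x +ℚ + 1 / suc y) ℚᵘ.+ toℚᵘ (+ 1 / suc z)
      ≈⟨ +-cong (toℚᵘ-homo-+ (+ 1 / suc x) (+ 1 / suc y)) (toℚᵘ-fromℚᵘ (+ 1 ℚᵘ./ suc z)) ⟩
    (toℚᵘ (+ 1 / suc x) ℚᵘ.+ toℚᵘ (+ 1 / suc y)) ℚᵘ.+ + 1 ℚᵘ./ suc z
      ≈⟨ +-cong (+-cong (toℚᵘ-fromℚᵘ (+ 1 ℚᵘ./ suc x)) (toℚᵘ-fromℚᵘ (+ 1 ℚᵘ./ suc y))) ≃-refl ⟩
    (+ 1 ℚᵘ./ suc x ℚᵘ.+ + 1 ℚᵘ./ suc y) ℚᵘ.+ + 1 ℚᵘ./ suc z ∎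
... | ℚᵘ.*≡* cross-multiplied =
  trans (sym (ℤ.abs-* (+ n) (+ (suc x * suc y * suc z))))
        (trans (cong ∣_∣ cross-multiplied) (cong (_* suc p) (numerator x y z)))
  where
  -- the numerator of the sum in the normal form computed by ℚᵘ addition
  numerator : ∀ x y z →
    suc (z + (y + 0 + suc (x + 0)) * suc z + suc (y + x * suc y + 0)) ≡
    suc x * suc y + (suc x + suc y) * suc z
  numerator = solve-∀

smallest-denominator-bound : ∀ {n p x y z} .{{_ : NonZero (y * z)}} → x ≤ y → y ≤ z →
  n * (x * y * z) ≡ (x * y + (x + y) * z) * p → n * x ≤ 3 * p
smallest-denominator-bound {n} {p} {x} {y} {z} x≤y y≤z eq = *-cancelʳ-≤ (n * x) (3 * p) (y * z) (begin
  n * x * (y * z)               ≡⟨ regroup n x y z ⟩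
  n * (x * y * z)               ≡⟨ eq ⟩
  (x * y + (x + y) * z) * p     ≤⟨ *-monoˡ-≤ p (+-mono-≤ (*-mono-≤ (≤-trans x≤y y≤z) (≤-refl {y}))
                                                           (*-monoˡ-≤ z (+-monoˡ-≤ y x≤y))) ⟩
  (z * y + (y + y) * z) * p     ≡⟨ collect y z p ⟩
  3 * p * (y * z)               ∎)
  where
  open ≤-Reasoning
  regroup : ∀ n x y z → n * x * (y * z) ≡ n * (x * y * z)
  regroup = solve-∀
  collect : ∀ y z p → (z * y + (y + y) * z) * p ≡ 3 * p * (y * z)
  collect = solve-∀

prime≡1[4]⇒∤4 : ∀ {p} → Prime p → p % 4 ≡ 1 → p ∤ 4
prime≡1[4]⇒∤4 {p} p-prime p%4≡1 p∣4 = no-such-prime p p-prime p%4≡1 (∣⇒≤ p∣4)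
  where
  no-such-prime : ∀ p → Prime p → p % 4 ≡ 1 → p ≤ 4 → ⊥
  no-such-prime 0 _ () _
  no-such-prime 1 p-prime _ _ = ¬prime[1] p-prime
  no-such-prime 2 _ () _
  no-such-prime 3 _ () _
  no-such-prime 4 _ () _
  no-such-prime (suc (suc (suc (suc (suc _))))) _ _ (s≤s (s≤s (s≤s (s≤s ()))))

prime∤m∤n⇒∤m*n : ∀ {p m n} → Prime p → p ∤ m → p ∤ n → p ∤ m * n
prime∤m∤n⇒∤m*n {m = m} {n} p-prime p∤m p∤n p∣mn with euclidsLemma m n p-prime p∣mn
... | inj₁ p∣m = p∤m p∣m
... | inj₂ p∣n = p∤n p∣n

prime∣m*n∤m⇒∣n : ∀ {p m n} → Prime p → p ∣ m * n → p ∤ m → p ∣ n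
prime∣m*n∤m⇒∣n {m = m} {n} p-prime p∣mn p∤m with euclidsLemma m n p-prime p∣mn
... | inj₁ p∣m = ⊥-elim (p∤m p∣m)
... | inj₂ p∣n = p∣n

z≡w*p⇒4w≡1+m*p : ∀ {p x y z w} .{{_ : NonZero z}} → Prime p → p ∤ x * y →
  4 * (x * y * z) ≡ (x * y + (x + y) * z) * p → z ≡ w * p →
  ∃ λ m → 1 + m * p ≡ w * 4
z≡w*p⇒4w≡1+m*p {z = z} {w = 0} _ _ _ z≡0 = ⊥-elim (≢-nonZero⁻¹ z z≡0)
z≡w*p⇒4w≡1+m*p {p} {x} {y} {w = suc v} p-prime p∤xy eq refl with p∣3+4v
  where
  instance _ = prime⇒nonZero p-prime
  w = suc v
  cancelled : x * y + x * y * (3 + 4 * v) ≡ x * y + (x + y) * w * p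
  cancelled = *-cancelʳ-≡ _ _ p (trans (regroupˡ x y v p) (trans eq (regroupʳ x y w p)))
    where
    regroupˡ : ∀ x y v p → (x * y + x * y * (3 + 4 * v)) * p ≡ 4 * (x * y * (suc v * p))
    regroupˡ = solve-∀
    regroupʳ : ∀ x y w p → (x * y + (x + y) * (w * p)) * p ≡ (x * y + (x + y) * w * p) * p
    regroupʳ = solve-∀
  p∣3+4v : p ∣ 3 + 4 * v
  p∣3+4v = prime∣m*n∤m⇒∣n p-prime (divides ((x + y) * w) (+-cancelˡ-≡ (x * y) _ _ cancelled)) p∤xy
... | divides m 3+4v≡mp = m , trans (cong suc (sym 3+4v≡mp)) (shift v)
  where
  shift : ∀ v → 4 + 4 * v ≡ suc v * 4
  shift = solve-∀

p≡1[4]⇒[4∣1+m*p⇒m≡4k+3] : ∀ {p m} → p % 4 ≡ 1 → 4 ∣ 1 + m * p → ∃ λ k → m ≡ 4 * k + 3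
p≡1[4]⇒[4∣1+m*p⇒m≡4k+3] {p} {m} p%4≡1 4∣1+mp = m div 4 , (begin
  m                       ≡⟨ m≡m%n+[m/n]*n m 4 ⟩
  m % 4 + m div 4 * 4     ≡⟨ cong (_+ m div 4 * 4) m%4≡3 ⟩
  3 + m div 4 * 4         ≡⟨ +-comm 3 (m div 4 * 4) ⟩
  m div 4 * 4 + 3         ≡⟨ cong (_+ 3) (*-comm (m div 4) 4) ⟩
  4 * (m div 4) + 3       ∎)
  where
  open ≡-Reasoning
  m%4≡3 : m % 4 ≡ 3
  m%4≡3 = begin
    m % 4                   ≡⟨ m%n%n≡m%n m 4 ⟨
    m % 4 % 4               ≡⟨ cong (_% 4) (*-identityʳ (m % 4)) ⟨
    m % 4 * 1 % 4           ≡⟨ cong (λ r → m % 4 * r % 4) p%4≡1 ⟨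
    m % 4 * (p % 4) % 4     ≡⟨ %-distribˡ-* m p 4 ⟨
    m * p % 4               ≡⟨ %-pred-≡0 {m * p} (n∣m⇒m%n≡0 (1 + m * p) 4 4∣1+mp) ⟩
    3                       ∎

4wp≡[4k+3]p²+p : ∀ k p w → 1 + (4 * k + 3) * p ≡ w * 4 → 4 * (w * p) ≡ (4 * k + 3) * p ^ 2 + p
4wp≡[4k+3]p²+p k p w 1+[4k+3]p≡4w = begin
  4 * (w * p)                   ≡⟨ reorder w p ⟩
  w * 4 * p                     ≡⟨ cong (_* p) 1+[4k+3]p≡4w ⟨
  (1 + (4 * k + 3) * p) * p     ≡⟨ expand k p ⟩
  (4 * k + 3) * p ^ 2 + p       ∎
  where
  open ≡-Reasoning
  reorder : ∀ w p → 4 * (w * p) ≡ w * 4 * p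
  reorder = solve-∀
  expand : ∀ k p → (1 + (4 * k + 3) * p) * p ≡ (4 * k + 3) * (p * (p * 1)) + p
  expand = solve-∀

largest-denominator-closed-form : ∀ {p x y z} .{{_ : NonZero z}} → Prime p → p % 4 ≡ 1 → p ∤ x * y →
  4 * (x * y * z) ≡ (x * y + (x + y) * z) * p → p ∣ z →
  ∃ λ k → 4 * z ≡ (4 * k + 3) * p ^ 2 + p
largest-denominator-closed-form {p} {x} {y} p-prime p%4≡1 p∤xy eq (divides w z≡wp)
  with z≡w*p⇒4w≡1+m*p {x = x} {y} {w = w} p-prime p∤xy eq z≡wp
... | m , 1+mp≡4w with p≡1[4]⇒[4∣1+m*p⇒m≡4k+3] {m = m} p%4≡1 (divides w 1+mp≡4w)
... | k , refl = k , trans (cong (4 *_) z≡wp) (4wp≡[4k+3]p²+p k p w 1+mp≡4w)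

proposition1 : (p : ℕ) → .{{_ : NonZero p}} → Prime p → p % 4 ≡ 1 →
    (x y z : ℕ) → .{{_ : NonZero x}} → .{{_ : NonZero y}} → .{{_ : NonZero z}} →
    x ≤ y → y ≤ z →
    (+ 4) / p ≡ ((+ 1) / x +ℚ (+ 1) / y) +ℚ (+ 1) / z →
    ¬ (p ∣ y) →
    ∃ λ (k : ℕ) → 4 * z ≡ (4 * k + 3) * p ^ 2 + p
proposition1 p p-prime p%4≡1 x y z x≤y y≤z eq p∤y =
  largest-denominator-closed-form {x = x} {y} p-prime p%4≡1 p∤xy cleared p∣z
  where
  instance _ = m*n≢0 y z
  cleared : 4 * (x * y * z) ≡ (x * y + (x + y) * z) * p
  cleared = n/p≡1/x+1/y+1/z⇒ 4 p x y z eq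
  x<p : x < p
  x<p = *-cancelˡ-< 4 x p
    (≤-<-trans (smallest-denominator-bound {4} x≤y y≤z cleared) (*-monoˡ-< p {3} {4} ≤-refl))
  p∤xy : p ∤ x * y
  p∤xy = prime∤m∤n⇒∤m*n p-prime (λ p∣x → <⇒≱ x<p (∣⇒≤ p∣x)) p∤y
  p∣xyz : p ∣ x * y * z
  p∣xyz = prime∣m*n∤m⇒∣n p-prime (divides (x * y + (x + y) * z) cleared) (prime≡1[4]⇒∤4 p-prime p%4≡1)
  p∣z : p ∣ z
  p∣z = prime∣m*n∤m⇒∣n p-prime p∣xyz p∤xy
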